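{- For integers $a,b\ge0$, $$\sum_{c=0}^{\min(a,b)}(\lambda;\lambda^2)_c\binom{a+b}{2c,\,a-c,\,b-c}_{\lambda}\lambda^{(a-c)(b-c)}=\binom{a+b}{a}_{\lambda^2}.$$
   Context: $(x;y)_n=\prod_{i=1}^n(1-xy^{i-1})$, $(x)_n=\prod_{i=1}^n(x^i-1)$. The $\lambda$-multinomial is $\binom{n}{m_1,\dots,m_r}_\lambda=\frac{(n)_\lambda}{(m_1)_\lambda\cdots(m_r)_\lambda}$ when $n=m_1+\dots+m_r$ and all $m_i\ge0$, and $0$ otherwise; $\binom{n}{m}_\lambda=\binom{n}{m,n-m}_\lambda$. The identity is in $\mathbb{Z}(\lambda)$ (equivalently polynomial in $\lambda$). -}

module Defs where

open import Data.Nat as ℕ using (ℕ; zero; suc; _∸_; _≤?_)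
open import Data.List using (List; []; _∷_; map; foldr; upTo)
open import Data.Rational using (ℚ; 0ℚ; 1ℚ; _+_; _*_; _-_; 1/_; ≢-nonZero)
open import Data.Rational.Properties using (_≟_)
open import Relation.Nullary using (yes; no)

_^_ : ℚ → ℕ → ℚ
x ^ zero  = 1ℚ
x ^ suc n = x * (x ^ n)

sumℚ : List ℚ → ℚ
sumℚ = foldr _+_ 0ℚ

prodℚ : List ℚ → ℚ
prodℚ = foldr _*_ 1ℚ

sumTo : ℕ → (ℕ → ℚ) → ℚ
sumTo n f = sumℚ (map f (upTo (suc n)))

-- total inverse: 1/q if q ≠ 0, and 0 otherwise (only ever used at nonzero q)
inv : ℚ → ℚ
inv q with q ≟ 0ℚ
... | yes _  = 0ℚ
... | no q≢0 = 1/_ q {{≢-nonZero q≢0}}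

poch : ℚ → ℚ → ℕ → ℚ
poch x y zero    = 1ℚ
poch x y (suc n) = poch x y n * (1ℚ - x * (y ^ n))

fac : ℚ → ℕ → ℚ
fac x zero    = 1ℚ
fac x (suc n) = fac x n * ((x ^ suc n) - 1ℚ)

sumℕ : List ℕ → ℕ
sumℕ = foldr ℕ._+_ 0

-- λ-multinomial (n ; m₁,…,m_r)_λ = (n)_λ / ((m₁)_λ ⋯ (m_r)_λ) if n = m₁+⋯+m_r, else 0
-- (the m_i are naturals, so the nonnegativity condition is automatic)
multinom : ℚ → ℕ → List ℕ → ℚ
multinom x n ms with n ℕ.≟ sumℕ ms
... | yes _ = fac x n * inv (prodℚ (map (fac x) ms))
... | no _  = 0ℚ

binom : ℚ → ℕ → ℕ → ℚ
binom x n m with m ≤? n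
... | yes _ = multinom x n (m ∷ (n ∸ m) ∷ [])
... | no _  = 0ℚ

{-# OPTIONS --safe #-}
-- Write q for λ. Dividing by (q)_{a+b} and using (q)_{2c} = (q;q²)_c (q²;q²)_c turns the identity into
--   Σ_c term(a,b,c) = (-q;q)_{a+b} / ((q²)_a (q²)_b),   term(a,b,c) = q^{(a-c)(b-c)} / ((q²;q²)_c (q)_{a-c} (q)_{b-c}).
-- The right side obeys (q^{2a+2} - 1) R(a+1,b) = (1 + q^{a+b+1}) R(a,b). For a < b the left side obeys the
-- same recurrence by creative telescoping: with the certificate G(c) = (1 - q^{2c}) q^{a+1-c} term(a+1,b,c),
-- the c-th summand of the recurrence is G(c+1) - G(c), which reduces to the Pascal rules
-- (q^{i+1} - 1) weight(i+1,j) = q^j weight(i,j) of weight(i,j) = q^{ij} / ((q)_i (q)_j).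
-- The case a = 0 is immediate and the symmetry in a and b covers a > b. Since q ≠ ±1, q² is a nonnegative
-- rational different from 1, so none of the q-factorials involved vanishes.
module Submission where

open import Defs
open import Data.Nat using (ℕ; _⊓_; _∸_) renaming (_+_ to _+ℕ_; _*_ to _*ℕ_)
open import Data.List using ([]; _∷_)
open import Data.Rational using (ℚ; 1ℚ; -_; _*_)
open import Relation.Binary.PropositionalEquality using (_≡_; _≢_)

import Data.Rational.Properties as QP
open import Algebra.Bundles using (CommutativeMonoid)
open import Algebra.Properties.CommutativeSemigroup (CommutativeMonoid.commutativeSemigroup QP.*-1-commutativeMonoid)
  using (interchange; x∙yz≈y∙xz)
open import Algebra.Properties.Group QP.+-0-group using (x∙y⁻¹≈ε⇒x≈y; x≈y⇒x∙y⁻¹≈ε)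
open import Data.Empty using (⊥-elim)
open import Data.List using (List; _∷ʳ_; [_]; map; upTo)
open import Data.List.Properties using (upTo-∷ʳ; map-++)
open import Data.Nat as ℕ using (zero; suc; _≤_; _<_; z≤n)
import Data.Nat.Properties as ℕP
open import Data.Nat.Tactic.RingSolver using () renaming (solve-∀ to ℕ-solve-∀)
open import Data.Rational using (0ℚ; _+_; _-_; 1/_; ≢-nonZero; NonNegative; Positive; nonNegative; nonPositive)
open import Data.Sum using (_⊎_; inj₁; inj₂)
open import Function using (_∘_)
open import Level using (0ℓ)
open import Relation.Binary.PropositionalEquality using (refl; sym; trans; cong; cong₂; subst; module ≡-Reasoning)
open import Relation.Nullary using (Dec; yes; no; contradiction)
open import Relation.Nullary.Decidable using (dec⇒maybe)
open import Tactic.RingSolver using (solve-∀)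
open import Tactic.RingSolver.Core.AlmostCommutativeRing using (AlmostCommutativeRing; fromCommutativeRing)

open ≡-Reasoning

-- The zero test lets the solver discard vanishing constant coefficients such as 0ℚ.
ℚ-ring : AlmostCommutativeRing 0ℓ 0ℓ
ℚ-ring = fromCommutativeRing QP.+-*-commutativeRing (λ p → dec⇒maybe (0ℚ QP.≟ p))

p*q≡0⇒p≡0∨q≡0 : ∀ p q → p * q ≡ 0ℚ → p ≡ 0ℚ ⊎ q ≡ 0ℚ
p*q≡0⇒p≡0∨q≡0 p q pq≡0 with p QP.≟ 0ℚ
... | yes p≡0 = inj₁ p≡0
... | no p≢0 = inj₂ (begin
  q               ≡⟨ sym (QP.*-identityˡ q) ⟩
  1ℚ * q          ≡⟨ cong (_* q) (sym (QP.*-inverseˡ p)) ⟩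
  1/ p * p * q    ≡⟨ QP.*-assoc (1/ p) p q ⟩
  1/ p * (p * q)  ≡⟨ cong (1/ p *_) pq≡0 ⟩
  1/ p * 0ℚ       ≡⟨ QP.*-zeroʳ (1/ p) ⟩
  0ℚ              ∎)
  where instance _ = ≢-nonZero p≢0

p≢0∧q≢0⇒p*q≢0 : ∀ {p q} → p ≢ 0ℚ → q ≢ 0ℚ → p * q ≢ 0ℚ
p≢0∧q≢0⇒p*q≢0 {p} {q} p≢0 q≢0 pq≡0 with p*q≡0⇒p≡0∨q≡0 p q pq≡0
... | inj₁ p≡0 = p≢0 p≡0
... | inj₂ q≡0 = q≢0 q≡0

p*q≢0⇒p≢0 : ∀ {p q} → p * q ≢ 0ℚ → p ≢ 0ℚ
p*q≢0⇒p≢0 {q = q} pq≢0 refl = pq≢0 (QP.*-zeroˡ q)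

p*q≢0⇒q≢0 : ∀ {p q} → p * q ≢ 0ℚ → q ≢ 0ℚ
p*q≢0⇒q≢0 {p} pq≢0 refl = pq≢0 (QP.*-zeroʳ p)

p≢q⇒p-q≢0 : ∀ {p q} → p ≢ q → p - q ≢ 0ℚ
p≢q⇒p-q≢0 {p} {q} p≢q p-q≡0 = p≢q (x∙y⁻¹≈ε⇒x≈y p q p-q≡0)

p≢q⇒q-p≢0 : ∀ {p q} → p ≢ q → q - p ≢ 0ℚ
p≢q⇒q-p≢0 p≢q = p≢q⇒p-q≢0 (λ q≡p → p≢q (sym q≡p))

inv-inverseˡ : ∀ {p} → p ≢ 0ℚ → inv p * p ≡ 1ℚ
inv-inverseˡ {p} p≢0 with p QP.≟ 0ℚ
... | yes p≡0 = ⊥-elim (p≢0 p≡0)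
... | no p≢0′ = QP.*-inverseˡ p {{≢-nonZero p≢0′}}

inv-inverseʳ : ∀ {p} → p ≢ 0ℚ → p * inv p ≡ 1ℚ
inv-inverseʳ {p} p≢0 = trans (QP.*-comm p (inv p)) (inv-inverseˡ p≢0)

inv-unique : ∀ {x p} → x * p ≡ 1ℚ → x ≡ inv p
inv-unique {x} {p} xp≡1 = begin
  x                ≡⟨ sym (QP.*-identityʳ x) ⟩
  x * 1ℚ           ≡⟨ cong (x *_) (sym (inv-inverseʳ p≢0)) ⟩
  x * (p * inv p)  ≡⟨ sym (QP.*-assoc x p (inv p)) ⟩
  x * p * inv p    ≡⟨ cong (_* inv p) xp≡1 ⟩
  1ℚ * inv p       ≡⟨ QP.*-identityˡ (inv p) ⟩
  inv p            ∎
  where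
  p≢0 : p ≢ 0ℚ
  p≢0 refl = QP.1≢0 (trans (sym xp≡1) (QP.*-zeroʳ x))

-- The total inverse is multiplicative even at 0, since inv 0ℚ ≡ 0ℚ.
inv-distrib-* : ∀ p q → inv (p * q) ≡ inv p * inv q
inv-distrib-* p q = by-cases (p QP.≟ 0ℚ) (q QP.≟ 0ℚ)
  where
  by-cases : Dec (p ≡ 0ℚ) → Dec (q ≡ 0ℚ) → inv (p * q) ≡ inv p * inv q
  by-cases (yes refl) _ = trans (cong inv (QP.*-zeroˡ q)) (sym (QP.*-zeroˡ (inv q)))
  by-cases (no _) (yes refl) = trans (cong inv (QP.*-zeroʳ p)) (sym (QP.*-zeroʳ (inv p)))
  by-cases (no p≢0) (no q≢0) = sym (inv-unique (begin
    inv p * inv q * (p * q)  ≡⟨ interchange (inv p) (inv q) p q ⟩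
    inv p * p * (inv q * q)  ≡⟨ cong₂ _*_ (inv-inverseˡ p≢0) (inv-inverseˡ q≢0) ⟩
    1ℚ                       ∎))

inv-*-cancelʳ : ∀ p {d} → d ≢ 0ℚ → d * inv (p * d) ≡ inv p
inv-*-cancelʳ p {d} d≢0 = begin
  d * inv (p * d)      ≡⟨ cong (d *_) (inv-distrib-* p d) ⟩
  d * (inv p * inv d)  ≡⟨ x∙yz≈y∙xz d (inv p) (inv d) ⟩
  inv p * (d * inv d)  ≡⟨ cong (inv p *_) (inv-inverseʳ d≢0) ⟩
  inv p * 1ℚ           ≡⟨ QP.*-identityʳ (inv p) ⟩
  inv p                ∎

*-cancelˡ : ∀ {k x y} → k ≢ 0ℚ → k * x ≡ k * y → x ≡ y
*-cancelˡ {k} {x} {y} k≢0 kx≡ky = begin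
  x                ≡⟨ cancel x ⟨
  inv k * (k * x)  ≡⟨ cong (inv k *_) kx≡ky ⟩
  inv k * (k * y)  ≡⟨ cancel y ⟩
  y                ∎
  where
  cancel : ∀ z → inv k * (k * z) ≡ z
  cancel z = trans (sym (QP.*-assoc (inv k) k z)) (trans (cong (_* z) (inv-inverseˡ k≢0)) (QP.*-identityˡ z))

^-distribˡ-+-* : ∀ x m n → x ^ (m +ℕ n) ≡ x ^ m * x ^ n
^-distribˡ-+-* x zero n = sym (QP.*-identityˡ (x ^ n))
^-distribˡ-+-* x (suc m) n = trans (cong (x *_) (^-distribˡ-+-* x m n)) (sym (QP.*-assoc x (x ^ m) (x ^ n)))

^-distribʳ-* : ∀ x y n → (x * y) ^ n ≡ x ^ n * y ^ n
^-distribʳ-* x y zero = refl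
^-distribʳ-* x y (suc n) = trans (cong (x * y *_) (^-distribʳ-* x y n)) (interchange x y (x ^ n) (y ^ n))

^-double : ∀ x n → x ^ (2 *ℕ n) ≡ (x * x) ^ n
^-double x n = begin
  x ^ (n +ℕ (n +ℕ 0))  ≡⟨ cong (λ m → x ^ (n +ℕ m)) (ℕP.+-identityʳ n) ⟩
  x ^ (n +ℕ n)         ≡⟨ ^-distribˡ-+-* x n n ⟩
  x ^ n * x ^ n        ≡⟨ ^-distribʳ-* x x n ⟨
  (x * x) ^ n          ∎

sumℚ-∷ʳ : ∀ (xs : List ℚ) x → sumℚ (xs ∷ʳ x) ≡ sumℚ xs + x
sumℚ-∷ʳ [] x = QP.+-comm x 0ℚ
sumℚ-∷ʳ (y ∷ ys) x = trans (cong (y +_) (sumℚ-∷ʳ ys x)) (sym (QP.+-assoc y (sumℚ ys) x))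

sumTo-suc : ∀ n f → sumTo (suc n) f ≡ sumTo n f + f (suc n)
sumTo-suc n f = begin
  sumℚ (map f (upTo (suc (suc n))))         ≡⟨ cong (sumℚ ∘ map f) (upTo-∷ʳ (suc n)) ⟨
  sumℚ (map f (upTo (suc n) ∷ʳ suc n))      ≡⟨ cong sumℚ (map-++ f (upTo (suc n)) [ suc n ]) ⟩
  sumℚ (map f (upTo (suc n)) ∷ʳ f (suc n))  ≡⟨ sumℚ-∷ʳ (map f (upTo (suc n))) (f (suc n)) ⟩
  sumTo n f + f (suc n)                     ∎

sumTo-cong : ∀ n {f g} → (∀ c → c ≤ n → f c ≡ g c) → sumTo n f ≡ sumTo n g
sumTo-cong zero f≗g = cong (_+ 0ℚ) (f≗g 0 z≤n)
sumTo-cong (suc n) {f} {g} f≗g = begin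
  sumTo (suc n) f        ≡⟨ sumTo-suc n f ⟩
  sumTo n f + f (suc n)  ≡⟨ cong₂ _+_ (sumTo-cong n (λ c c≤n → f≗g c (ℕP.m≤n⇒m≤1+n c≤n))) (f≗g (suc n) ℕP.≤-refl) ⟩
  sumTo n g + g (suc n)  ≡⟨ sumTo-suc n g ⟨
  sumTo (suc n) g        ∎

*-distribˡ-sumTo : ∀ n k f → k * sumTo n f ≡ sumTo n (λ c → k * f c)
*-distribˡ-sumTo zero k f = trans (QP.*-distribˡ-+ k (f 0) 0ℚ) (cong (k * f 0 +_) (QP.*-zeroʳ k))
*-distribˡ-sumTo (suc n) k f = begin
  k * sumTo (suc n) f                      ≡⟨ cong (k *_) (sumTo-suc n f) ⟩
  k * (sumTo n f + f (suc n))              ≡⟨ QP.*-distribˡ-+ k (sumTo n f) (f (suc n)) ⟩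
  k * sumTo n f + k * f (suc n)            ≡⟨ cong (_+ k * f (suc n)) (*-distribˡ-sumTo n k f) ⟩
  sumTo n (λ c → k * f c) + k * f (suc n)  ≡⟨ sumTo-suc n (λ c → k * f c) ⟨
  sumTo (suc n) (λ c → k * f c)            ∎

sumTo-sub : ∀ n f g → sumTo n (λ c → f c - g c) ≡ sumTo n f - sumTo n g
sumTo-sub zero f g = sub₀ (f 0) (g 0)
  where
  sub₀ : ∀ x y → x - y + 0ℚ ≡ x + 0ℚ - (y + 0ℚ)
  sub₀ = solve-∀ ℚ-ring
sumTo-sub (suc n) f g = begin
  sumTo (suc n) (λ c → f c - g c)                          ≡⟨ sumTo-suc n (λ c → f c - g c) ⟩
  sumTo n (λ c → f c - g c) + (f (suc n) - g (suc n))      ≡⟨ cong (_+ (f (suc n) - g (suc n))) (sumTo-sub n f g) ⟩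
  sumTo n f - sumTo n g + (f (suc n) - g (suc n))          ≡⟨ subₛ (sumTo n f) (sumTo n g) (f (suc n)) (g (suc n)) ⟩
  sumTo n f + f (suc n) - (sumTo n g + g (suc n))          ≡⟨ cong₂ _-_ (sumTo-suc n f) (sumTo-suc n g) ⟨
  sumTo (suc n) f - sumTo (suc n) g                        ∎
  where
  subₛ : ∀ s t x y → s - t + (x - y) ≡ s + x - (t + y)
  subₛ = solve-∀ ℚ-ring

sumTo-telescope : ∀ n (G : ℕ → ℚ) → sumTo n (λ c → G (suc c) - G c) ≡ G (suc n) - G 0
sumTo-telescope zero G = QP.+-identityʳ (G 1 - G 0)
sumTo-telescope (suc n) G = begin
  sumTo (suc n) (λ c → G (suc c) - G c)
    ≡⟨ sumTo-suc n (λ c → G (suc c) - G c) ⟩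
  sumTo n (λ c → G (suc c) - G c) + (G (suc (suc n)) - G (suc n))
    ≡⟨ cong (_+ (G (suc (suc n)) - G (suc n))) (sumTo-telescope n G) ⟩
  G (suc n) - G 0 + (G (suc (suc n)) - G (suc n))
    ≡⟨ cancel (G 0) (G (suc n)) (G (suc (suc n))) ⟩
  G (suc (suc n)) - G 0
    ∎
  where
  cancel : ∀ x y z → y - x + (z - y) ≡ z - x
  cancel = solve-∀ ℚ-ring

geometric-sum : ∀ r n → (r - 1ℚ) * sumTo n (r ^_) ≡ r ^ suc n - 1ℚ
geometric-sum r zero = geometric₀ r
  where
  geometric₀ : ∀ r → (r - 1ℚ) * (1ℚ + 0ℚ) ≡ r * 1ℚ - 1ℚ
  geometric₀ = solve-∀ ℚ-ring
geometric-sum r (suc n) = begin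
  (r - 1ℚ) * sumTo (suc n) (r ^_)                   ≡⟨ cong ((r - 1ℚ) *_) (sumTo-suc n (r ^_)) ⟩
  (r - 1ℚ) * (sumTo n (r ^_) + r ^ suc n)           ≡⟨ QP.*-distribˡ-+ (r - 1ℚ) (sumTo n (r ^_)) (r ^ suc n) ⟩
  (r - 1ℚ) * sumTo n (r ^_) + (r - 1ℚ) * r ^ suc n  ≡⟨ cong (_+ (r - 1ℚ) * r ^ suc n) (geometric-sum r n) ⟩
  r ^ suc n - 1ℚ + (r - 1ℚ) * r ^ suc n             ≡⟨ geometricₛ r (r ^ suc n) ⟩
  r ^ suc (suc n) - 1ℚ                              ∎
  where
  geometricₛ : ∀ r x → x - 1ℚ + (r - 1ℚ) * x ≡ r * x - 1ℚ
  geometricₛ = solve-∀ ℚ-ring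

square-nonNeg : ∀ p → NonNegative (p * p)
square-nonNeg p with QP.≤-total 0ℚ p
... | inj₁ 0≤p = QP.nonNeg*nonNeg⇒nonNeg p {{nonNegative 0≤p}} p {{nonNegative 0≤p}}
-- Despite its name, the library lemma nonPos*nonPos⇒nonPos concludes NonNegative.
... | inj₂ p≤0 = QP.nonPos*nonPos⇒nonPos p {{nonPositive p≤0}} p {{nonPositive p≤0}}

^-nonNeg : ∀ {r} → NonNegative r → ∀ n → NonNegative (r ^ n)
^-nonNeg r≥0 zero = _
^-nonNeg {r} r≥0 (suc n) = QP.nonNeg*nonNeg⇒nonNeg r {{r≥0}} (r ^ n) {{^-nonNeg r≥0 n}}

geometric-sum-pos : ∀ {r} → NonNegative r → ∀ n → Positive (sumTo n (r ^_))
geometric-sum-pos r≥0 zero = _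
geometric-sum-pos {r} r≥0 (suc n) = subst Positive (sym (sumTo-suc n (r ^_)))
  (QP.pos+nonNeg⇒pos (sumTo n (r ^_)) {{geometric-sum-pos r≥0 n}} (r ^ suc n) {{^-nonNeg {r} r≥0 (suc n)}})

^-suc≢1 : ∀ {r} → NonNegative r → r ≢ 1ℚ → ∀ n → r ^ suc n ≢ 1ℚ
^-suc≢1 {r} r≥0 r≢1 n rⁿ⁺¹≡1 =
  p≢0∧q≢0⇒p*q≢0 (p≢q⇒p-q≢0 r≢1) sum≢0 (trans (geometric-sum r n) (x≈y⇒x∙y⁻¹≈ε rⁿ⁺¹≡1))
  where
  sum≢0 : sumTo n (r ^_) ≢ 0ℚ
  sum≢0 sum≡0 = QP.<⇒≢ (QP.positive⁻¹ _ {{geometric-sum-pos r≥0 n}}) (sym sum≡0)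

p≢±1⇒p*p≢1 : ∀ {p} → p ≢ 1ℚ → p ≢ - 1ℚ → p * p ≢ 1ℚ
p≢±1⇒p*p≢1 {p} p≢1 p≢-1 p*p≡1 =
  p≢0∧q≢0⇒p*q≢0 (p≢q⇒p-q≢0 p≢1) (p≢q⇒p-q≢0 p≢-1) (trans (difference-of-squares p) (x≈y⇒x∙y⁻¹≈ε p*p≡1))
  where
  difference-of-squares : ∀ p → (p - 1ℚ) * (p - - 1ℚ) ≡ p * p - 1ℚ
  difference-of-squares = solve-∀ ℚ-ring

fac≢0 : ∀ {x} → (∀ n → x ^ suc n ≢ 1ℚ) → ∀ n → fac x n ≢ 0ℚ
fac≢0 xⁿ⁺¹≢1 zero = QP.1≢0
fac≢0 xⁿ⁺¹≢1 (suc n) = p≢0∧q≢0⇒p*q≢0 (fac≢0 xⁿ⁺¹≢1 n) (p≢q⇒p-q≢0 (xⁿ⁺¹≢1 n))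

fac-square : ∀ x n → fac (x * x) n ≡ fac x n * poch (- x) x n
fac-square x zero = refl
fac-square x (suc n) = begin
  fac (x * x) n * ((x * x) ^ suc n - 1ℚ)
    ≡⟨ cong₂ (λ f y → f * (y - 1ℚ)) (fac-square x n) (^-distribʳ-* x x (suc n)) ⟩
  fac x n * poch (- x) x n * (x ^ suc n * x ^ suc n - 1ℚ)
    ≡⟨ split (fac x n) (poch (- x) x n) x (x ^ n) ⟩
  fac x n * (x ^ suc n - 1ℚ) * (poch (- x) x n * (1ℚ - - x * x ^ n))
    ∎
  where
  split : ∀ f p x y → f * p * (x * y * (x * y) - 1ℚ) ≡ f * (x * y - 1ℚ) * (p * (1ℚ - - x * y))
  split = solve-∀ ℚ-ring

fac-double : ∀ x n → fac x (2 *ℕ n) ≡ poch x (x * x) n * poch (x * x) (x * x) n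
fac-double x zero = refl
fac-double x (suc n) = begin
  fac x (2 *ℕ suc n)
    ≡⟨ cong (fac x) (ℕP.*-suc 2 n) ⟩
  fac x (2 *ℕ n) * (x * x ^ (2 *ℕ n) - 1ℚ) * (x * (x * x ^ (2 *ℕ n)) - 1ℚ)
    ≡⟨ cong₂ (λ f y → f * (x * y - 1ℚ) * (x * (x * y) - 1ℚ)) (fac-double x n) (^-double x n) ⟩
  poch x (x * x) n * poch (x * x) (x * x) n * (x * (x * x) ^ n - 1ℚ) * (x * (x * (x * x) ^ n) - 1ℚ)
    ≡⟨ interleave (poch x (x * x) n) (poch (x * x) (x * x) n) x ((x * x) ^ n) ⟩
  poch x (x * x) n * (1ℚ - x * (x * x) ^ n) * (poch (x * x) (x * x) n * (1ℚ - x * x * (x * x) ^ n))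
    ∎
  where
  interleave : ∀ a b x y → a * b * (x * y - 1ℚ) * (x * (x * y) - 1ℚ) ≡ a * (1ℚ - x * y) * (b * (1ℚ - x * x * y))
  interleave = solve-∀ ℚ-ring

multinom-unfold : ∀ x n ms → n ≡ sumℕ ms → multinom x n ms ≡ fac x n * inv (prodℚ (map (fac x) ms))
multinom-unfold x n ms n≡Σms with n ℕ.≟ sumℕ ms
... | yes _ = refl
... | no n≢Σms = contradiction n≡Σms n≢Σms

binom-unfold : ∀ x n m → m ≤ n → binom x n m ≡ multinom x n (m ∷ (n ∸ m) ∷ [])
binom-unfold x n m m≤n with m ℕ.≤? n
... | yes _ = refl
... | no m≰n = contradiction m≤n m≰n

a+b≡2c+[a∸c]+[b∸c] : ∀ {a b c} → c ≤ a → c ≤ b → a +ℕ b ≡ 2 *ℕ c +ℕ ((a ∸ c) +ℕ ((b ∸ c) +ℕ 0))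
a+b≡2c+[a∸c]+[b∸c] {a} {b} {c} c≤a c≤b =
  trans (cong₂ _+ℕ_ (sym (ℕP.m+[n∸m]≡n c≤a)) (sym (ℕP.m+[n∸m]≡n c≤b))) (regroup c (a ∸ c) (b ∸ c))
  where
  regroup : ∀ c i j → c +ℕ i +ℕ (c +ℕ j) ≡ 2 *ℕ c +ℕ (i +ℕ (j +ℕ 0))
  regroup = ℕ-solve-∀

module DiagonalSum (q : ℚ) (q≢1 : q ≢ 1ℚ) (q≢-1 : q ≢ - 1ℚ) where

  q² : ℚ
  q² = q * q

  q²ⁿ⁺¹≢1 : ∀ n → q² ^ suc n ≢ 1ℚ
  q²ⁿ⁺¹≢1 = ^-suc≢1 (square-nonNeg q) (p≢±1⇒p*p≢1 q≢1 q≢-1)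

  qⁿ⁺¹≢1 : ∀ n → q ^ suc n ≢ 1ℚ
  qⁿ⁺¹≢1 n qⁿ⁺¹≡1 = q²ⁿ⁺¹≢1 n (begin
    q² ^ suc n             ≡⟨ ^-distribʳ-* q q (suc n) ⟩
    q ^ suc n * q ^ suc n  ≡⟨ cong₂ _*_ qⁿ⁺¹≡1 qⁿ⁺¹≡1 ⟩
    1ℚ                     ∎)

  invFac invFac² invPoch : ℕ → ℚ
  invFac n = inv (fac q n)
  invFac² n = inv (fac q² n)
  invPoch n = inv (poch q² q² n)

  invFac-step : ∀ n → (q ^ suc n - 1ℚ) * invFac (suc n) ≡ invFac n
  invFac-step n = inv-*-cancelʳ (fac q n) (p≢q⇒p-q≢0 (qⁿ⁺¹≢1 n))

  invFac²-step : ∀ n → (q² ^ suc n - 1ℚ) * invFac² (suc n) ≡ invFac² n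
  invFac²-step n = inv-*-cancelʳ (fac q² n) (p≢q⇒p-q≢0 (q²ⁿ⁺¹≢1 n))

  invPoch-step : ∀ n → (1ℚ - q² ^ suc n) * invPoch (suc n) ≡ invPoch n
  invPoch-step n = inv-*-cancelʳ (poch q² q² n) (p≢q⇒q-p≢0 (q²ⁿ⁺¹≢1 n))

  weight : ℕ → ℕ → ℚ
  weight i j = q ^ (i *ℕ j) * (invFac i * invFac j)

  weight-comm : ∀ i j → weight i j ≡ weight j i
  weight-comm i j = cong₂ (λ k x → q ^ k * x) (ℕP.*-comm i j) (QP.*-comm (invFac i) (invFac j))

  weight-sucˡ : ∀ i j → (q ^ suc i - 1ℚ) * weight (suc i) j ≡ q ^ j * weight i j
  weight-sucˡ i j = begin
    (q ^ suc i - 1ℚ) * (q ^ (j +ℕ i *ℕ j) * (invFac (suc i) * invFac j))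
      ≡⟨ cong (λ x → (q ^ suc i - 1ℚ) * (x * (invFac (suc i) * invFac j))) (^-distribˡ-+-* q j (i *ℕ j)) ⟩
    (q ^ suc i - 1ℚ) * (q ^ j * q ^ (i *ℕ j) * (invFac (suc i) * invFac j))
      ≡⟨ regroup (q ^ suc i - 1ℚ) (q ^ j) (q ^ (i *ℕ j)) (invFac (suc i)) (invFac j) ⟩
    q ^ j * (q ^ (i *ℕ j) * ((q ^ suc i - 1ℚ) * invFac (suc i) * invFac j))
      ≡⟨ cong (λ x → q ^ j * (q ^ (i *ℕ j) * (x * invFac j))) (invFac-step i) ⟩
    q ^ j * weight i j
      ∎
    where
    regroup : ∀ d y z a b → d * (y * z * (a * b)) ≡ y * (z * (d * a * b))
    regroup = solve-∀ ℚ-ring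

  weight-sucʳ : ∀ i j → (q ^ suc j - 1ℚ) * weight i (suc j) ≡ q ^ i * weight i j
  weight-sucʳ i j = begin
    (q ^ suc j - 1ℚ) * weight i (suc j)  ≡⟨ cong ((q ^ suc j - 1ℚ) *_) (weight-comm i (suc j)) ⟩
    (q ^ suc j - 1ℚ) * weight (suc j) i  ≡⟨ weight-sucˡ j i ⟩
    q ^ i * weight j i                   ≡⟨ cong (q ^ i *_) (weight-comm j i) ⟩
    q ^ i * weight i j                   ∎

  creative-identity : ∀ c i j →
      (q² ^ c * q² ^ suc i - 1ℚ) * (invPoch c * weight (suc i) (suc j))
    - (1ℚ + q² ^ c * (q ^ suc i * q ^ suc j)) * (invPoch c * weight i (suc j))
    ≡ (1ℚ - q² ^ suc c) * q ^ i * (invPoch (suc c) * weight i j)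
    - (1ℚ - q² ^ c) * q ^ suc i * (invPoch c * weight (suc i) (suc j))
  creative-identity c i j = begin
    (X * (q² * q² ^ i) - 1ℚ) * (Z * A) - (1ℚ + X * (q * x * (q * y))) * (Z * B)
      ≡⟨ cong (λ p → (X * (q² * p) - 1ℚ) * (Z * A) - (1ℚ + X * (q * x * (q * y))) * (Z * B)) (^-distribʳ-* q q i) ⟩
    (X * (q * q * (x * x)) - 1ℚ) * (Z * A) - (1ℚ + X * (q * x * (q * y))) * (Z * B)
      ≡⟨ expand X Z A B q x y ⟩
    Z * ((X * (q * x) + 1ℚ) * ((q * x - 1ℚ) * A) - X * (q * x) * (q * y * B) - B) - (1ℚ - X) * (q * x) * (Z * A)
      ≡⟨ cong (λ p → Z * ((X * (q * x) + 1ℚ) * p - X * (q * x) * (q * y * B) - B) - (1ℚ - X) * (q * x) * (Z * A)) (weight-sucˡ i (suc j)) ⟩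
    Z * ((X * (q * x) + 1ℚ) * (q * y * B) - X * (q * x) * (q * y * B) - B) - (1ℚ - X) * (q * x) * (Z * A)
      ≡⟨ cong (λ p → Z * p - (1ℚ - X) * (q * x) * (Z * A)) (collect X B q x y) ⟩
    Z * ((q * y - 1ℚ) * B) - (1ℚ - X) * (q * x) * (Z * A)
      ≡⟨ cong (λ p → Z * p - (1ℚ - X) * (q * x) * (Z * A)) (weight-sucʳ i j) ⟩
    Z * (x * C) - (1ℚ - X) * (q * x) * (Z * A)
      ≡⟨ cong (λ z → z * (x * C) - (1ℚ - X) * (q * x) * (Z * A)) (invPoch-step c) ⟨
    (1ℚ - q² ^ suc c) * invPoch (suc c) * (x * C) - (1ℚ - X) * (q * x) * (Z * A)
      ≡⟨ cong (_- (1ℚ - X) * (q * x) * (Z * A)) (interchange (1ℚ - q² ^ suc c) (invPoch (suc c)) x C) ⟩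
    (1ℚ - q² ^ suc c) * x * (invPoch (suc c) * C) - (1ℚ - X) * (q * x) * (Z * A)
      ∎
    where
    X Z A B C x y : ℚ
    X = q² ^ c
    Z = invPoch c
    A = weight (suc i) (suc j)
    B = weight i (suc j)
    C = weight i j
    x = q ^ i
    y = q ^ j
    expand : ∀ X Z A B q x y →
        (X * (q * q * (x * x)) - 1ℚ) * (Z * A) - (1ℚ + X * (q * x * (q * y))) * (Z * B)
      ≡ Z * ((X * (q * x) + 1ℚ) * ((q * x - 1ℚ) * A) - X * (q * x) * (q * y * B) - B) - (1ℚ - X) * (q * x) * (Z * A)
    expand = solve-∀ ℚ-ring
    collect : ∀ X B q x y → (X * (q * x) + 1ℚ) * (q * y * B) - X * (q * x) * (q * y * B) - B ≡ (q * y - 1ℚ) * B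
    collect = solve-∀ ℚ-ring

  term : ℕ → ℕ → ℕ → ℚ
  term a b c = invPoch c * weight (a ∸ c) (b ∸ c)

  -- The factor 1 - q^{2c} turns 1/(q²;q²)_c into 1/(q²;q²)_{c-1}, so the certificate vanishes at c = 0
  -- and at c = a + 1 it cancels the one summand of diagonalSum (suc a) b that diagonalSum a b lacks.
  certificate : ℕ → ℕ → ℕ → ℚ
  certificate a b c = (1ℚ - q² ^ c) * q ^ (suc a ∸ c) * term (suc a) b c

  term-telescopes : ∀ {a b c} → c ≤ a → c < b →
      (q² ^ suc a - 1ℚ) * term (suc a) b c - (1ℚ + q ^ suc (a +ℕ b)) * term a b c
    ≡ certificate a b (suc c) - certificate a b c
  term-telescopes {a} {b} {c} c≤a c<b = begin
    (q² ^ suc a - 1ℚ) * (Z * weight (suc a ∸ c) (b ∸ c)) - (1ℚ + q ^ suc (a +ℕ b)) * (Z * weight i (b ∸ c))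
      ≡⟨ cong₂ (λ m n → (q² ^ suc a - 1ℚ) * (Z * weight m n) - (1ℚ + q ^ suc (a +ℕ b)) * (Z * weight i n)) sa∸c≡1+i b∸c≡1+j ⟩
    (q² ^ suc a - 1ℚ) * (Z * weight (suc i) (suc j)) - (1ℚ + q ^ suc (a +ℕ b)) * (Z * weight i (suc j))
      ≡⟨ cong₂ (λ k l → (k - 1ℚ) * (Z * weight (suc i) (suc j)) - (1ℚ + l) * (Z * weight i (suc j))) q²^sa q^s[a+b] ⟩
    (q² ^ c * q² ^ suc i - 1ℚ) * (Z * weight (suc i) (suc j)) - (1ℚ + q² ^ c * (q ^ suc i * q ^ suc j)) * (Z * weight i (suc j))
      ≡⟨ creative-identity c i j ⟩
    certificate a b (suc c) - (1ℚ - q² ^ c) * q ^ suc i * (Z * weight (suc i) (suc j))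
      ≡⟨ cong₂ (λ m n → certificate a b (suc c) - (1ℚ - q² ^ c) * q ^ m * (Z * weight m n)) sa∸c≡1+i b∸c≡1+j ⟨
    certificate a b (suc c) - certificate a b c
      ∎
    where
    Z : ℚ
    Z = invPoch c
    i j : ℕ
    i = a ∸ c
    j = b ∸ suc c
    c+i≡a : c +ℕ i ≡ a
    c+i≡a = ℕP.m+[n∸m]≡n c≤a
    c+1+j≡b : suc c +ℕ j ≡ b
    c+1+j≡b = ℕP.m+[n∸m]≡n c<b
    sa∸c≡1+i : suc a ∸ c ≡ suc i
    sa∸c≡1+i = ℕP.+-∸-assoc 1 c≤a
    b∸c≡1+j : b ∸ c ≡ suc j
    b∸c≡1+j = ℕP.+-∸-assoc 1 c<b
    q²^sa : q² ^ suc a ≡ q² ^ c * q² ^ suc i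
    q²^sa = begin
      q² ^ suc a         ≡⟨ cong (λ n → q² ^ suc n) c+i≡a ⟨
      q² ^ suc (c +ℕ i)  ≡⟨ cong (q² ^_) (ℕP.+-suc c i) ⟨
      q² ^ (c +ℕ suc i)  ≡⟨ ^-distribˡ-+-* q² c (suc i) ⟩
      q² ^ c * q² ^ suc i  ∎
    q^s[a+b] : q ^ suc (a +ℕ b) ≡ q² ^ c * (q ^ suc i * q ^ suc j)
    q^s[a+b] = begin
      q ^ suc (a +ℕ b)                       ≡⟨ cong₂ (λ m n → q ^ suc (m +ℕ n)) c+i≡a c+1+j≡b ⟨
      q ^ suc (c +ℕ i +ℕ suc (c +ℕ j))       ≡⟨ cong (q ^_) (regroup c i j) ⟩
      q ^ (2 *ℕ c +ℕ (suc i +ℕ suc j))       ≡⟨ ^-distribˡ-+-* q (2 *ℕ c) (suc i +ℕ suc j) ⟩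
      q ^ (2 *ℕ c) * q ^ (suc i +ℕ suc j)    ≡⟨ cong₂ _*_ (^-double q c) (^-distribˡ-+-* q (suc i) (suc j)) ⟩
      q² ^ c * (q ^ suc i * q ^ suc j)       ∎
      where
      regroup : ∀ c i j → suc (c +ℕ i +ℕ suc (c +ℕ j)) ≡ 2 *ℕ c +ℕ (suc i +ℕ suc j)
      regroup = ℕ-solve-∀

  certificate-zero : ∀ a b → certificate a b 0 ≡ 0ℚ
  certificate-zero a b = trans (cong (_* term (suc a) b 0) (QP.*-zeroˡ (q ^ suc a))) (QP.*-zeroˡ (term (suc a) b 0))

  certificate-last : ∀ a b → certificate a b (suc a) ≡ (1ℚ - q² ^ suc a) * term (suc a) b (suc a)
  certificate-last a b = begin
    (1ℚ - q² ^ suc a) * q ^ (a ∸ a) * T  ≡⟨ cong (λ n → (1ℚ - q² ^ suc a) * q ^ n * T) (ℕP.n∸n≡0 a) ⟩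
    (1ℚ - q² ^ suc a) * 1ℚ * T           ≡⟨ cong (_* T) (QP.*-identityʳ (1ℚ - q² ^ suc a)) ⟩
    (1ℚ - q² ^ suc a) * T                ∎
    where
    T : ℚ
    T = term (suc a) b (suc a)

  sumTo-term-telescopes : ∀ {a b} → a < b →
      (q² ^ suc a - 1ℚ) * sumTo a (term (suc a) b) - (1ℚ + q ^ suc (a +ℕ b)) * sumTo a (term a b)
    ≡ certificate a b (suc a) - certificate a b 0
  sumTo-term-telescopes {a} {b} a<b = begin
    k * sumTo a T₁ - l * sumTo a T₀
      ≡⟨ cong₂ _-_ (*-distribˡ-sumTo a k T₁) (*-distribˡ-sumTo a l T₀) ⟩
    sumTo a (λ c → k * T₁ c) - sumTo a (λ c → l * T₀ c)
      ≡⟨ sumTo-sub a (λ c → k * T₁ c) (λ c → l * T₀ c) ⟨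
    sumTo a (λ c → k * T₁ c - l * T₀ c)
      ≡⟨ sumTo-cong a (λ c c≤a → term-telescopes c≤a (ℕP.<-≤-trans (ℕ.s≤s c≤a) a<b)) ⟩
    sumTo a (λ c → certificate a b (suc c) - certificate a b c)
      ≡⟨ sumTo-telescope a (certificate a b) ⟩
    certificate a b (suc a) - certificate a b 0
      ∎
    where
    k l : ℚ
    k = q² ^ suc a - 1ℚ
    l = 1ℚ + q ^ suc (a +ℕ b)
    T₀ T₁ : ℕ → ℚ
    T₀ = term a b
    T₁ = term (suc a) b

  diagonalSum : ℕ → ℕ → ℚ
  diagonalSum a b = sumTo (a ⊓ b) (term a b)

  diagonalSum-recurrence : ∀ {a b} → a < b →
    (q² ^ suc a - 1ℚ) * diagonalSum (suc a) b ≡ (1ℚ + q ^ suc (a +ℕ b)) * diagonalSum a b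
  diagonalSum-recurrence {a} {b} a<b = begin
    k * sumTo (suc a ⊓ b) T₁                    ≡⟨ cong (λ n → k * sumTo n T₁) (ℕP.m≤n⇒m⊓n≡m a<b) ⟩
    k * sumTo (suc a) T₁                        ≡⟨ cong (k *_) (sumTo-suc a T₁) ⟩
    k * (sumTo a T₁ + T₁ (suc a))               ≡⟨ rearrange k l (sumTo a T₁) (sumTo a T₀) (T₁ (suc a)) ⟩
    (k * sumTo a T₁ - l * sumTo a T₀) + k * T₁ (suc a) + l * sumTo a T₀
      ≡⟨ cong (λ x → x + k * T₁ (suc a) + l * sumTo a T₀) (sumTo-term-telescopes a<b) ⟩
    certificate a b (suc a) - certificate a b 0 + k * T₁ (suc a) + l * sumTo a T₀
      ≡⟨ cong₂ (λ x y → x - y + k * T₁ (suc a) + l * sumTo a T₀) (certificate-last a b) (certificate-zero a b) ⟩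
    (1ℚ - q² ^ suc a) * T₁ (suc a) - 0ℚ + k * T₁ (suc a) + l * sumTo a T₀
      ≡⟨ cancel (q² ^ suc a) (T₁ (suc a)) (l * sumTo a T₀) ⟩
    l * sumTo a T₀                              ≡⟨ cong (λ n → l * sumTo n T₀) (ℕP.m≤n⇒m⊓n≡m (ℕP.<⇒≤ a<b)) ⟨
    l * sumTo (a ⊓ b) T₀                        ∎
    where
    k l : ℚ
    k = q² ^ suc a - 1ℚ
    l = 1ℚ + q ^ suc (a +ℕ b)
    T₀ T₁ : ℕ → ℚ
    T₀ = term a b
    T₁ = term (suc a) b
    rearrange : ∀ k l s s′ x → k * (s + x) ≡ (k * s - l * s′) + k * x + l * s′
    rearrange = solve-∀ ℚ-ring
    cancel : ∀ y x z → (1ℚ - y) * x - 0ℚ + (y - 1ℚ) * x + z ≡ z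
    cancel = solve-∀ ℚ-ring

  closedForm : ℕ → ℕ → ℚ
  closedForm a b = poch (- q) q (a +ℕ b) * (invFac² a * invFac² b)

  closedForm-recurrence : ∀ a b →
    (q² ^ suc a - 1ℚ) * closedForm (suc a) b ≡ (1ℚ + q ^ suc (a +ℕ b)) * closedForm a b
  closedForm-recurrence a b = begin
    k * (poch (- q) q n * (1ℚ - - q * q ^ n) * (invFac² (suc a) * invFac² b))
      ≡⟨ regroup k (poch (- q) q n) q (q ^ n) (invFac² (suc a)) (invFac² b) ⟩
    (1ℚ + q * q ^ n) * (poch (- q) q n * (k * invFac² (suc a) * invFac² b))
      ≡⟨ cong (λ x → (1ℚ + q * q ^ n) * (poch (- q) q n * (x * invFac² b))) (invFac²-step a) ⟩
    (1ℚ + q * q ^ n) * closedForm a b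
      ∎
    where
    k : ℚ
    k = q² ^ suc a - 1ℚ
    n : ℕ
    n = a +ℕ b
    regroup : ∀ k p q y e f → k * (p * (1ℚ - - q * y) * (e * f)) ≡ (1ℚ + q * y) * (p * (k * e * f))
    regroup = solve-∀ ℚ-ring

  diagonalSum≡closedForm-zero : ∀ b → diagonalSum 0 b ≡ closedForm 0 b
  diagonalSum≡closedForm-zero b = begin
    1ℚ * (1ℚ * (1ℚ * invFac b)) + 0ℚ  ≡⟨ simplify (invFac b) ⟩
    invFac b * 1ℚ                     ≡⟨ cong (invFac b *_) (inv-inverseʳ P≢0) ⟨
    invFac b * (P * inv P)            ≡⟨ x∙yz≈y∙xz (invFac b) P (inv P) ⟩
    P * (invFac b * inv P)            ≡⟨ cong (P *_) (inv-distrib-* (fac q b) P) ⟨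
    P * inv (fac q b * P)             ≡⟨ cong (λ x → P * inv x) (fac-square q b) ⟨
    P * invFac² b                     ≡⟨ cong (P *_) (QP.*-identityˡ (invFac² b)) ⟨
    closedForm 0 b                    ∎
    where
    P : ℚ
    P = poch (- q) q b
    P≢0 : P ≢ 0ℚ
    P≢0 = p*q≢0⇒q≢0 {fac q b} (subst (_≢ 0ℚ) (fac-square q b) (fac≢0 q²ⁿ⁺¹≢1 b))
    simplify : ∀ x → 1ℚ * (1ℚ * (1ℚ * x)) + 0ℚ ≡ x * 1ℚ
    simplify = solve-∀ ℚ-ring

  diagonalSum≡closedForm-≤ : ∀ {a b} → a ≤ b → diagonalSum a b ≡ closedForm a b
  diagonalSum≡closedForm-≤ {zero} {b} _ = diagonalSum≡closedForm-zero b
  diagonalSum≡closedForm-≤ {suc a} {b} a<b = *-cancelˡ (p≢q⇒p-q≢0 (q²ⁿ⁺¹≢1 a)) (begin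
    (q² ^ suc a - 1ℚ) * diagonalSum (suc a) b    ≡⟨ diagonalSum-recurrence a<b ⟩
    (1ℚ + q ^ suc (a +ℕ b)) * diagonalSum a b    ≡⟨ cong ((1ℚ + q ^ suc (a +ℕ b)) *_) (diagonalSum≡closedForm-≤ (ℕP.<⇒≤ a<b)) ⟩
    (1ℚ + q ^ suc (a +ℕ b)) * closedForm a b     ≡⟨ closedForm-recurrence a b ⟨
    (q² ^ suc a - 1ℚ) * closedForm (suc a) b     ∎)

  diagonalSum-comm : ∀ a b → diagonalSum a b ≡ diagonalSum b a
  diagonalSum-comm a b = trans (cong (λ n → sumTo n (term a b)) (ℕP.⊓-comm a b))
    (sumTo-cong (b ⊓ a) (λ c _ → cong (invPoch c *_) (weight-comm (a ∸ c) (b ∸ c))))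

  closedForm-comm : ∀ a b → closedForm a b ≡ closedForm b a
  closedForm-comm a b = cong₂ (λ n x → poch (- q) q n * x) (ℕP.+-comm a b) (QP.*-comm (invFac² a) (invFac² b))

  diagonalSum≡closedForm : ∀ a b → diagonalSum a b ≡ closedForm a b
  diagonalSum≡closedForm a b with ℕP.≤-total a b
  ... | inj₁ a≤b = diagonalSum≡closedForm-≤ a≤b
  ... | inj₂ b≤a = trans (diagonalSum-comm a b) (trans (diagonalSum≡closedForm-≤ b≤a) (closedForm-comm b a))

  inv-denominator : ∀ c i j →
    inv (fac q (2 *ℕ c) * (fac q i * (fac q j * 1ℚ))) ≡ inv (poch q q² c) * invPoch c * (invFac i * invFac j)
  inv-denominator c i j = begin
    inv (fac q (2 *ℕ c) * (fac q i * (fac q j * 1ℚ)))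
      ≡⟨ inv-distrib-* (fac q (2 *ℕ c)) (fac q i * (fac q j * 1ℚ)) ⟩
    inv (fac q (2 *ℕ c)) * inv (fac q i * (fac q j * 1ℚ))
      ≡⟨ cong₂ (λ x y → inv x * inv (fac q i * y)) (fac-double q c) (QP.*-identityʳ (fac q j)) ⟩
    inv (poch q q² c * poch q² q² c) * inv (fac q i * fac q j)
      ≡⟨ cong₂ _*_ (inv-distrib-* (poch q q² c) (poch q² q² c)) (inv-distrib-* (fac q i) (fac q j)) ⟩
    inv (poch q q² c) * invPoch c * (invFac i * invFac j)
      ∎

  summand≡fac*term : ∀ {a b c} → c ≤ a → c ≤ b →
      poch q q² c * multinom q (a +ℕ b) ((2 *ℕ c) ∷ (a ∸ c) ∷ (b ∸ c) ∷ []) * q ^ ((a ∸ c) *ℕ (b ∸ c))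
    ≡ fac q (a +ℕ b) * term a b c
  summand≡fac*term {a} {b} {c} c≤a c≤b = begin
    p * multinom q n (2 *ℕ c ∷ i ∷ j ∷ []) * q ^ (i *ℕ j)
      ≡⟨ cong (λ m → p * m * q ^ (i *ℕ j)) (multinom-unfold q n (2 *ℕ c ∷ i ∷ j ∷ []) (a+b≡2c+[a∸c]+[b∸c] c≤a c≤b)) ⟩
    p * (fac q n * inv (fac q (2 *ℕ c) * (fac q i * (fac q j * 1ℚ)))) * q ^ (i *ℕ j)
      ≡⟨ cong (λ m → p * (fac q n * m) * q ^ (i *ℕ j)) (inv-denominator c i j) ⟩
    p * (fac q n * (inv p * invPoch c * (invFac i * invFac j))) * q ^ (i *ℕ j)
      ≡⟨ regroup p (inv p) (fac q n) (invPoch c) (q ^ (i *ℕ j)) (invFac i * invFac j) ⟩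
    p * inv p * (fac q n * term a b c)
      ≡⟨ cong (_* (fac q n * term a b c)) (inv-inverseʳ p≢0) ⟩
    1ℚ * (fac q n * term a b c)
      ≡⟨ QP.*-identityˡ (fac q n * term a b c) ⟩
    fac q n * term a b c
      ∎
    where
    p : ℚ
    p = poch q q² c
    n i j : ℕ
    n = a +ℕ b
    i = a ∸ c
    j = b ∸ c
    p≢0 : p ≢ 0ℚ
    p≢0 = p*q≢0⇒p≢0 (subst (_≢ 0ℚ) (fac-double q c) (fac≢0 qⁿ⁺¹≢1 (2 *ℕ c)))
    regroup : ∀ p p′ f z e g → p * (f * (p′ * z * g)) * e ≡ p * p′ * (f * (z * (e * g)))
    regroup = solve-∀ ℚ-ring

  binom≡fac*closedForm : ∀ a b → binom q² (a +ℕ b) a ≡ fac q (a +ℕ b) * closedForm a b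
  binom≡fac*closedForm a b = begin
    binom q² n a
      ≡⟨ binom-unfold q² n a (ℕP.m≤m+n a b) ⟩
    multinom q² n (a ∷ (n ∸ a) ∷ [])
      ≡⟨ multinom-unfold q² n (a ∷ (n ∸ a) ∷ []) n≡a+[n∸a] ⟩
    fac q² n * inv (fac q² a * (fac q² (n ∸ a) * 1ℚ))
      ≡⟨ cong₂ (λ f m → f * inv (fac q² a * m)) (fac-square q n) (trans (QP.*-identityʳ (fac q² (n ∸ a))) (cong (fac q²) (ℕP.m+n∸m≡n a b))) ⟩
    fac q n * poch (- q) q n * inv (fac q² a * fac q² b)
      ≡⟨ cong (fac q n * poch (- q) q n *_) (inv-distrib-* (fac q² a) (fac q² b)) ⟩
    fac q n * poch (- q) q n * (invFac² a * invFac² b)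
      ≡⟨ QP.*-assoc (fac q n) (poch (- q) q n) (invFac² a * invFac² b) ⟩
    fac q n * closedForm a b
      ∎
    where
    n : ℕ
    n = a +ℕ b
    n≡a+[n∸a] : n ≡ a +ℕ ((n ∸ a) +ℕ 0)
    n≡a+[n∸a] = sym (trans (cong (a +ℕ_) (ℕP.+-identityʳ (n ∸ a))) (ℕP.m+[n∸m]≡n (ℕP.m≤m+n a b)))

mainTheorem4 : (λ' : ℚ) → λ' ≢ 1ℚ → λ' ≢ - 1ℚ → (a b : ℕ) →
    sumTo (a ⊓ b) (λ c → poch λ' (λ' * λ') c * multinom λ' (a +ℕ b) ((2 *ℕ c) ∷ (a ∸ c) ∷ (b ∸ c) ∷ []) * (λ' ^ ((a ∸ c) *ℕ (b ∸ c))))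
      ≡ binom (λ' * λ') (a +ℕ b) a
mainTheorem4 q q≢1 q≢-1 a b = begin
  sumTo (a ⊓ b) (λ c → poch q q² c * multinom q (a +ℕ b) ((2 *ℕ c) ∷ (a ∸ c) ∷ (b ∸ c) ∷ []) * q ^ ((a ∸ c) *ℕ (b ∸ c)))
    ≡⟨ sumTo-cong (a ⊓ b) (λ c c≤a⊓b → summand≡fac*term (ℕP.m≤n⊓o⇒m≤n a b c≤a⊓b) (ℕP.m≤n⊓o⇒m≤o a b c≤a⊓b)) ⟩
  sumTo (a ⊓ b) (λ c → fac q (a +ℕ b) * term a b c)
    ≡⟨ *-distribˡ-sumTo (a ⊓ b) (fac q (a +ℕ b)) (term a b) ⟨
  fac q (a +ℕ b) * diagonalSum a b
    ≡⟨ cong (fac q (a +ℕ b) *_) (diagonalSum≡closedForm a b) ⟩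
  fac q (a +ℕ b) * closedForm a b
    ≡⟨ binom≡fac*closedForm a b ⟨
  binom q² (a +ℕ b) a
    ∎
  where open DiagonalSum q q≢1 q≢-1
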